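{- For $n\geq 0$, $$F_n^M(x,y,q)=q^{\binom{n}{2}}F_n^{M'}\left(x,y,\frac{1}{q}\right).$$
   Context: $S_n(R)$ is the set of permutations of $[n]$ containing no subsequence order isomorphic to any pattern in $R$. For $\pi=p_1\dots p_n$, $maj(\pi)=\sum_{i:\,p_i>p_{i+1}} i$. For $\pi\in S_n(123,132,213)$ (a concatenation of increasing blocks of size $1$ or $2$, each block larger than all later blocks), let $s(\pi)$, $d(\pi)$ be the numbers of its maximal increasing runs of length $1$ and $2$ respectively. For $\pi\in S_n(231,312,321)$ (a concatenation of decreasing blocks of size $1$ or $2$, each block smaller than all later blocks), let $s(\pi)$, $d(\pi)$ be the numbers of its maximal decreasing runs of length $1$ and $2$ respectively. Define $F_n^M(x,y,q)=\sum_{\pi\in S_n(123,132,213)}x^{s(\pi)}y^{d(\pi)}q^{maj(\pi)}$ and $F_n^{M'}(x,y,q)=\sum_{\pi\in S_n(231,312,321)}x^{s(\pi)}y^{d(\pi)}q^{maj(\pi)}$. -}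

module Defs where

open import Level using (Level)
open import Data.Bool using (Bool; true; false; _∧_; not; if_then_else_)
open import Data.Nat using (ℕ; zero; suc; _<ᵇ_; _≡ᵇ_)
import Data.Nat as ℕ
open import Data.List using (List; []; _∷_; [_]; map; _++_; concatMap; filter; length; foldr; zipWith)
open import Data.Bool.ListAction using (any; all)
open import Data.Product using (_×_; _,_)
open import Relation.Nullary.Decidable using (Dec; yes; no)
open import Data.Bool using (T)
open import Data.Bool.Properties using (T?)
open import Algebra.Bundles using (CommutativeRing)

-- Permutations of [n] = {1,…,n} in one-line notation, as lists of values.
-- Enumerated by inserting the new maximum n+1 into every position.
insertions : ℕ → List ℕ → List (List ℕ)
insertions a [] = [ a ∷ [] ]
insertions a (x ∷ xs) = (a ∷ x ∷ xs) ∷ map (x ∷_) (insertions a xs)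

perms : ℕ → List (List ℕ)
perms zero = [ [] ]
perms (suc n) = concatMap (insertions (suc n)) (perms n)

subseqs : List ℕ → List (List ℕ)
subseqs [] = [ [] ]
subseqs (x ∷ xs) = map (x ∷_) (subseqs xs) ++ subseqs xs

pairs : List ℕ → List (ℕ × ℕ)
pairs [] = []
pairs (x ∷ xs) = map (x ,_) xs ++ pairs xs

-- order isomorphism of two sequences (of distinct entries)
orderIso : List ℕ → List ℕ → Bool
orderIso a b = (length a ≡ᵇ length b) ∧
  all (λ b → b) (zipWith (λ { (u , v) (u' , v') → eqB (u <ᵇ v) (u' <ᵇ v') }) (pairs a) (pairs b))
  where
  eqB : Bool → Bool → Bool
  eqB true c = c
  eqB false c = not c

contains : List ℕ → List ℕ → Bool
contains π σ = any (orderIso σ) (subseqs π)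

avoids : List (List ℕ) → List ℕ → Bool
avoids R π = not (any (contains π) R)

Av : ℕ → List (List ℕ) → List (List ℕ)
Av n R = filter (λ π → T? (avoids R π)) (perms n)

-- major index: sum of positions i (1-indexed) with p_i > p_{i+1}
majFrom : ℕ → List ℕ → ℕ
majFrom k [] = 0
majFrom k (x ∷ []) = 0
majFrom k (x ∷ y ∷ rest) = (if y <ᵇ x then k else 0) ℕ.+ majFrom (suc k) (y ∷ rest)

maj : List ℕ → ℕ
maj = majFrom 1

runsBy : (ℕ → ℕ → Bool) → List ℕ → List (List ℕ)
runsBy r [] = []
runsBy r (x ∷ xs) with runsBy r xs
... | [] = [ x ∷ [] ]
... | [] ∷ rs = (x ∷ []) ∷ rs
... | (y ∷ ys) ∷ rs = if r x y then (x ∷ y ∷ ys) ∷ rs else (x ∷ []) ∷ (y ∷ ys) ∷ rs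

ascRuns : List ℕ → List (List ℕ)
ascRuns = runsBy (λ x y → x <ᵇ y)

descRuns : List ℕ → List (List ℕ)
descRuns = runsBy (λ x y → y <ᵇ x)

countLen : ℕ → List (List ℕ) → ℕ
countLen k rs = length (filter (λ r → T? (length r ≡ᵇ k)) rs)

p123 p132 p213 p231 p312 p321 : List ℕ
p123 = 1 ∷ 2 ∷ 3 ∷ []
p132 = 1 ∷ 3 ∷ 2 ∷ []
p213 = 2 ∷ 1 ∷ 3 ∷ []
p231 = 2 ∷ 3 ∷ 1 ∷ []
p312 = 3 ∷ 1 ∷ 2 ∷ []
p321 = 3 ∷ 2 ∷ 1 ∷ []

M : List (List ℕ)
M = p123 ∷ p132 ∷ p213 ∷ []

M' : List (List ℕ)
M' = p231 ∷ p312 ∷ p321 ∷ []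

module GF {c ℓ : Level} (R : CommutativeRing c ℓ) where
  open CommutativeRing R

  pow : Carrier → ℕ → Carrier
  pow a zero = 1#
  pow a (suc n) = a * pow a n

  sumR : List Carrier → Carrier
  sumR = foldr _+_ 0#

  -- F_n^M(x,y,q): s,d = numbers of maximal increasing runs of length 1,2
  FM : ℕ → Carrier → Carrier → Carrier → Carrier
  FM n x y q = sumR (map (λ π → pow x (countLen 1 (ascRuns π)) * pow y (countLen 2 (ascRuns π)) * pow q (maj π)) (Av n M))

  -- F_n^{M'}(x,y,q): s,d = numbers of maximal decreasing runs of length 1,2
  FM' : ℕ → Carrier → Carrier → Carrier → Carrier
  FM' n x y q = sumR (map (λ π → pow x (countLen 1 (descRuns π)) * pow y (countLen 2 (descRuns π)) * pow q (maj π)) (Av n M'))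

-- The complement π ↦ πᶜ, πᶜᵢ = n + 1 − πᵢ, is an involution of Sₙ that reverses every
-- comparison. Hence it maps the patterns 123, 132, 213 to 321, 312, 231, and so
-- Sₙ(123,132,213) onto Sₙ(231,312,321); it turns maximal increasing runs into maximal
-- decreasing runs of the same lengths; and each position i < n is a descent of exactly
-- one of π and πᶜ, so maj π + maj πᶜ = 1 + 2 + ⋯ + (n − 1) = C(n,2). Reindexing the sum
-- defining F_n^M by π ↦ πᶜ then matches q^(maj π) = q^C(n,2) · (q⁻¹)^(maj πᶜ) termwise.
module Submission where

open import Defs
open import Level using (Level)
open import Algebra.Bundles using (CommutativeRing)
open import Function using (_∘_; Equivalence)
open import Data.Bool using (Bool; true; false; not; _∧_; if_then_else_; T)
open import Data.Bool.Properties using (T-≡; not-involutive; ∨-isCommutativeMonoid)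
open import Data.Bool.ListAction using (any; or)
open import Data.Nat using (ℕ; zero; suc; _<ᵇ_; _≡ᵇ_; _≤_; _<_; _∸_; _+_; s≤s)
open import Data.Nat.Properties
  using ( ≡ᵇ⇒≡; +-assoc; +-commutativeSemigroup; ≤-refl; m≤n⇒m≤1+n; <-irrefl; +-∸-assoc; m+n∸n≡m
        ; <⇒<ᵇ; <ᵇ⇒<; ≤⇒≯; <-cmp; ∸-monoʳ-<; <⇒≤)
open import Algebra.Properties.CommutativeSemigroup +-commutativeSemigroup
  using () renaming (x∙yz≈y∙xz to m+[n+o]≡n+[m+o])
open import Data.Nat.Combinatorics using (_C_; nC1≡n; nCk+nC[k+1]≡[n+1]C[k+1])
open import Data.List using (List; []; _∷_; map; _++_; concat; concatMap; filter; length)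
open import Data.List.Properties
  using (length-map; map-++; map-∘; map-cong-local; concatMap-++; concatMap-map; map-concatMap)
open import Data.List.Relation.Unary.All as All using (All; []; _∷_)
import Data.List.Relation.Unary.All.Properties as AllP
open import Data.List.Relation.Unary.AllPairs using ([]; _∷_)
open import Data.List.Relation.Unary.Unique.Propositional using (Unique)
open import Data.List.Relation.Binary.Permutation.Propositional
  using (_↭_; refl; prep; swap; trans; ↭-sym; ↭⇒↭ₛ; ↭⇒↭ₛ′; module PermutationReasoning)
open import Data.List.Relation.Binary.Permutation.Propositional.Properties
  using (++⁺; ++⁺ˡ; shifts; map⁺; All-resp-↭; ↭-length; ↭-reverse)
open import Data.List.Relation.Binary.Permutation.Setoid.Properties using (Unique-resp-↭; foldr-commMonoid)
open import Data.List.Membership.Propositional using (_∈_; find)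
open import Data.List.Membership.Propositional.Properties using (∈-map⁻; ∈-concatMap⁻)
open import Data.List.Relation.Unary.Any using (here; there)
open import Data.Product using (_×_; _,_; proj₁)
open import Relation.Binary.Definitions using (tri<; tri≈; tri>)
open import Relation.Binary.PropositionalEquality
  using (_≡_; _≢_; refl; sym; cong; cong₂; subst; ≢-sym; module ≡-Reasoning)
  renaming (trans to ≡-trans; setoid to ≡-setoid)
open import Relation.Nullary using (contradiction)
open import Relation.Nullary.Decidable using (T?)

private
  variable
    A B D : Set

-- Enumerating permutations

concatMap-concatMap : (f : B → List D) (g : A → List B) (xs : List A) →
                      concatMap f (concatMap g xs) ≡ concatMap (concatMap f ∘ g) xs
concatMap-concatMap f g [] = refl
concatMap-concatMap f g (x ∷ xs) =
  ≡-trans (concatMap-++ f (g x) (concatMap g xs)) (cong (concatMap f (g x) ++_) (concatMap-concatMap f g xs))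

concatMap⁺ : (f : A → List B) {xs ys : List A} → xs ↭ ys → concatMap f xs ↭ concatMap f ys
concatMap⁺ f refl = refl
concatMap⁺ f (prep x p) = ++⁺ˡ (f x) (concatMap⁺ f p)
concatMap⁺ f (swap x y p) = trans (shifts (f x) (f y)) (++⁺ˡ (f y) (++⁺ˡ (f x) (concatMap⁺ f p)))
concatMap⁺ f (trans p q) = trans (concatMap⁺ f p) (concatMap⁺ f q)

concatMap-↭ : {f g : A → List B} (xs : List A) → (∀ x → f x ↭ g x) → concatMap f xs ↭ concatMap g xs
concatMap-↭ [] f↭g = refl
concatMap-↭ (x ∷ xs) f↭g = ++⁺ (f↭g x) (concatMap-↭ xs f↭g)

insertions-map-∷ : ∀ a x (ws : List (List ℕ)) →
  concatMap (insertions a) (map (x ∷_) ws) ↭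
  map (a ∷_) (map (x ∷_) ws) ++ map (x ∷_) (concatMap (insertions a) ws)
insertions-map-∷ a x [] = refl
insertions-map-∷ a x (w ∷ ws) = prep (a ∷ x ∷ w) (begin
    x∷ (insertions a w) ++ concatMap (insertions a) (map (x ∷_) ws)
  ↭⟨ ++⁺ˡ (x∷ (insertions a w)) (insertions-map-∷ a x ws) ⟩
    x∷ (insertions a w) ++ map (a ∷_) (x∷ ws) ++ x∷ (concatMap (insertions a) ws)
  ↭⟨ shifts (x∷ (insertions a w)) (map (a ∷_) (x∷ ws)) ⟩
    map (a ∷_) (x∷ ws) ++ x∷ (insertions a w) ++ x∷ (concatMap (insertions a) ws)
  ≡⟨ cong (map (a ∷_) (x∷ ws) ++_) (map-++ (x ∷_) (insertions a w) _) ⟨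
    map (a ∷_) (x∷ ws) ++ x∷ (insertions a w ++ concatMap (insertions a) ws) ∎)
  where
  open PermutationReasoning
  x∷ : List (List ℕ) → List (List ℕ)
  x∷ = map (x ∷_)

insertions-comm : ∀ a b xs →
  concatMap (insertions a) (insertions b xs) ↭ concatMap (insertions b) (insertions a xs)
insertions-comm a b [] = swap _ _ refl
insertions-comm a b (x ∷ ys) = begin
  concatMap (insertions a) (insertions b (x ∷ ys))
    ↭⟨ prep _ (prep _ (++⁺ˡ Ba (insertions-map-∷ a x (insertions b ys)))) ⟩
  (a ∷ b ∷ x ∷ ys) ∷ (b ∷ a ∷ x ∷ ys) ∷ Ba ++ Ab ++ x∷ (concatMap (insertions a) (insertions b ys))
    ↭⟨ swap _ _ (shifts Ba Ab) ⟩
  (b ∷ a ∷ x ∷ ys) ∷ (a ∷ b ∷ x ∷ ys) ∷ Ab ++ Ba ++ x∷ (concatMap (insertions a) (insertions b ys))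
    ↭⟨ prep _ (prep _ (++⁺ˡ Ab (++⁺ˡ Ba (map⁺ (x ∷_) (insertions-comm a b ys))))) ⟩
  (b ∷ a ∷ x ∷ ys) ∷ (a ∷ b ∷ x ∷ ys) ∷ Ab ++ Ba ++ x∷ (concatMap (insertions b) (insertions a ys))
    ↭⟨ prep _ (prep _ (++⁺ˡ Ab (insertions-map-∷ b x (insertions a ys)))) ⟨
  concatMap (insertions b) (insertions a (x ∷ ys)) ∎
  where
  open PermutationReasoning
  x∷ : List (List ℕ) → List (List ℕ)
  x∷ = map (x ∷_)
  Ba Ab : List (List ℕ)
  Ba = map (b ∷_) (x∷ (insertions a ys))
  Ab = map (a ∷_) (x∷ (insertions b ys))

map-insertions : ∀ (f : ℕ → ℕ) a xs → map (map f) (insertions a xs) ≡ insertions (f a) (map f xs)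
map-insertions f a [] = refl
map-insertions f a (x ∷ xs) = cong ((f a ∷ f x ∷ map f xs) ∷_) (begin
  map (map f) (map (x ∷_) (insertions a xs)) ≡⟨ map-∘ (insertions a xs) ⟨
  map (map f ∘ (x ∷_)) (insertions a xs)     ≡⟨ map-∘ (insertions a xs) ⟩
  map (f x ∷_) (map (map f) (insertions a xs)) ≡⟨ cong (map (f x ∷_)) (map-insertions f a xs) ⟩
  map (f x ∷_) (insertions (f a) (map f xs)) ∎)
  where open ≡-Reasoning

∈insertions⇒↭ : ∀ a σ {π} → π ∈ insertions a σ → π ↭ a ∷ σ
∈insertions⇒↭ a [] (here refl) = refl
∈insertions⇒↭ a (x ∷ xs) (here refl) = refl
∈insertions⇒↭ a (x ∷ xs) (there m) with ∈-map⁻ (x ∷_) m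
... | τ , τ∈ , refl = trans (prep x (∈insertions⇒↭ a xs τ∈)) (swap x a refl)

-- Sₙ₊₁ is equally obtained by inserting 1 into the shifted permutations of [n];
-- complementation exchanges this construction with the one defining perms.
insertMin : List ℕ → List (List ℕ)
insertMin π = insertions 1 (map suc π)

perms-insertMin : ∀ n → concatMap insertMin (perms n) ↭ perms (suc n)
perms-insertMin zero = refl
perms-insertMin (suc n) = begin
  concatMap insertMin (concatMap (insertions (suc n)) (perms n))
    ≡⟨ concatMap-concatMap insertMin (insertions (suc n)) (perms n) ⟩
  concatMap (concatMap insertMin ∘ insertions (suc n)) (perms n)
    ↭⟨ concatMap-↭ (perms n) insertMax-insertMin ⟩
  concatMap (concatMap (insertions (suc (suc n))) ∘ insertMin) (perms n)
    ≡⟨ concatMap-concatMap (insertions (suc (suc n))) insertMin (perms n) ⟨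
  concatMap (insertions (suc (suc n))) (concatMap insertMin (perms n))
    ↭⟨ concatMap⁺ (insertions (suc (suc n))) (perms-insertMin n) ⟩
  perms (suc (suc n)) ∎
  where
  open PermutationReasoning
  insertMax-insertMin : ∀ π → concatMap insertMin (insertions (suc n) π) ↭
                              concatMap (insertions (suc (suc n))) (insertMin π)
  insertMax-insertMin π = begin
    concatMap insertMin (insertions (suc n) π)
      ≡⟨ concatMap-map (insertions 1) (map suc) (insertions (suc n) π) ⟨
    concatMap (insertions 1) (map (map suc) (insertions (suc n) π))
      ≡⟨ cong (concatMap (insertions 1)) (map-insertions suc (suc n) π) ⟩
    concatMap (insertions 1) (insertions (suc (suc n)) (map suc π))
      ↭⟨ insertions-comm 1 (suc (suc n)) (map suc π) ⟩
    concatMap (insertions (suc (suc n))) (insertMin π) ∎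

IsPerm : ℕ → List ℕ → Set
IsPerm n π = All (_≤ n) π × Unique π × length π ≡ n

∈perms⇒IsPerm : ∀ n {π} → π ∈ perms n → IsPerm n π
∈perms⇒IsPerm zero (here refl) = [] , [] , refl
∈perms⇒IsPerm (suc n) π∈ with find (∈-concatMap⁻ (insertions (suc n)) {xs = perms n} π∈)
... | σ , σ∈ , π∈ins with ∈perms⇒IsPerm n σ∈ | ∈insertions⇒↭ (suc n) σ π∈ins
... | σ≤n , σ! , |σ| | π↭ =
  All-resp-↭ (↭-sym π↭) (≤-refl ∷ All.map m≤n⇒m≤1+n σ≤n) ,
  Unique-resp-↭ (≡-setoid ℕ) (↭⇒↭ₛ (↭-sym π↭))
    (All.map (λ v≤n v≡ → <-irrefl (sym v≡) (s≤s v≤n)) σ≤n ∷ σ!) ,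
  ≡-trans (↭-length π↭) (cong suc |σ|)

-- Complementation

compl : ℕ → ℕ → ℕ
compl n v = suc n ∸ v

complement : ℕ → List ℕ → List ℕ
complement n = map (compl n)

compl-suc : ∀ n {v} → v ≤ suc n → compl (suc n) v ≡ suc (compl n v)
compl-suc n v≤ = +-∸-assoc 1 v≤

complement-insertMax : ∀ n {π} → All (_≤ n) π →
  map (complement (suc n)) (insertions (suc n) π) ≡ insertMin (complement n π)
complement-insertMax n {π} π≤n = begin
  map (complement (suc n)) (insertions (suc n) π)
    ≡⟨ map-insertions (compl (suc n)) (suc n) π ⟩
  insertions (compl (suc n) (suc n)) (complement (suc n) π)
    ≡⟨ cong₂ insertions (m+n∸n≡m 1 n) complement-shift ⟩
  insertMin (complement n π) ∎
  where
  open ≡-Reasoning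
  complement-shift : complement (suc n) π ≡ map suc (complement n π)
  complement-shift =
    ≡-trans (map-cong-local (All.map (λ v≤n → compl-suc n (m≤n⇒m≤1+n v≤n)) π≤n)) (map-∘ π)

perms-complement : ∀ n → map (complement n) (perms n) ↭ perms n
perms-complement zero = refl
perms-complement (suc n) = begin
  map (complement (suc n)) (concatMap (insertions (suc n)) (perms n))
    ≡⟨ map-concatMap (complement (suc n)) (insertions (suc n)) (perms n) ⟩
  concatMap (map (complement (suc n)) ∘ insertions (suc n)) (perms n)
    ≡⟨ cong concat (map-cong-local (All.tabulate λ π∈ →
         complement-insertMax n (proj₁ (∈perms⇒IsPerm n π∈)))) ⟩
  concatMap (insertMin ∘ complement n) (perms n)
    ≡⟨ concatMap-map insertMin (complement n) (perms n) ⟨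
  concatMap insertMin (map (complement n) (perms n))
    ↭⟨ concatMap⁺ insertMin (perms-complement n) ⟩
  concatMap insertMin (perms n)
    ↭⟨ perms-insertMin n ⟩
  perms (suc n) ∎
  where open PermutationReasoning

<⇒<ᵇ≡true : ∀ {m n} → m < n → (m <ᵇ n) ≡ true
<⇒<ᵇ≡true m<n = Equivalence.to T-≡ (<⇒<ᵇ m<n)

≥⇒<ᵇ≡false : ∀ {m n} → n ≤ m → (m <ᵇ n) ≡ false
≥⇒<ᵇ≡false {m} {n} n≤m with m <ᵇ n in eq
... | false = refl
... | true = contradiction (<ᵇ⇒< m n (subst T (sym eq) _)) (≤⇒≯ n≤m)

compl-<ᵇ : ∀ n {x y} → x ≤ n → y ≤ n → (compl n y <ᵇ compl n x) ≡ (x <ᵇ y)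
compl-<ᵇ n {x} {y} x≤n y≤n with <-cmp x y
... | tri< x<y _ _ rewrite <⇒<ᵇ≡true x<y = <⇒<ᵇ≡true (∸-monoʳ-< x<y (m≤n⇒m≤1+n y≤n))
... | tri≈ _ refl _ rewrite ≥⇒<ᵇ≡false (≤-refl {x}) = ≥⇒<ᵇ≡false (≤-refl {compl n x})
... | tri> _ _ y<x rewrite ≥⇒<ᵇ≡false (<⇒≤ y<x) =
  ≥⇒<ᵇ≡false (<⇒≤ (∸-monoʳ-< y<x (m≤n⇒m≤1+n x≤n)))

>ᵇ≡not-<ᵇ : ∀ {u v} → u ≢ v → (v <ᵇ u) ≡ not (u <ᵇ v)
>ᵇ≡not-<ᵇ {u} {v} u≢v with <-cmp u v
... | tri< u<v _ _ rewrite <⇒<ᵇ≡true u<v = ≥⇒<ᵇ≡false (<⇒≤ u<v)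
... | tri≈ _ u≡v _ = contradiction u≡v u≢v
... | tri> _ _ v<u rewrite <⇒<ᵇ≡true v<u | ≥⇒<ᵇ≡false (<⇒≤ v<u) = refl

compl-<ᵇ-not : ∀ n {u v} → u ≤ n → v ≤ n → u ≢ v → (compl n u <ᵇ compl n v) ≡ not (u <ᵇ v)
compl-<ᵇ-not n u≤n v≤n u≢v = ≡-trans (compl-<ᵇ n v≤n u≤n) (>ᵇ≡not-<ᵇ u≢v)

-- Patterns

orderIso-≢length : ∀ σ τ → length σ ≢ length τ → orderIso σ τ ≡ false
orderIso-≢length σ τ |σ|≢|τ| with length σ ≡ᵇ length τ in eq
... | false = refl
... | true = contradiction (≡ᵇ⇒≡ (length σ) (length τ) (subst T (sym eq) _)) |σ|≢|τ|

orderIso-complement-≢length : ∀ m n σ τ → length σ ≢ length τ →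
                              orderIso (complement m σ) (complement n τ) ≡ orderIso σ τ
orderIso-complement-≢length m n σ τ |σ|≢|τ| = ≡-trans
  (orderIso-≢length (complement m σ) (complement n τ) λ e →
    |σ|≢|τ| (≡-trans (sym (length-map (compl m) σ)) (≡-trans e (length-map (compl n) τ))))
  (sym (orderIso-≢length σ τ |σ|≢|τ|))

orderIso-complement-≢3 : ∀ n {σ} → σ ∈ M → ∀ τ → 3 ≢ length τ →
                         orderIso (complement 3 σ) (complement n τ) ≡ orderIso σ τ
orderIso-complement-≢3 n (here refl)                 τ = orderIso-complement-≢length 3 n p123 τ
orderIso-complement-≢3 n (there (here refl))         τ = orderIso-complement-≢length 3 n p132 τ
orderIso-complement-≢3 n (there (there (here refl))) τ = orderIso-complement-≢length 3 n p213 τ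

not-≡-swap : ∀ {a b} → a ≡ not b → not a ≡ b
not-≡-swap {b = b} refl = not-involutive b

∧₃-cong : ∀ {a b c a' b' c'} → a ≡ a' → b ≡ b' → c ≡ c' →
          a ∧ (b ∧ (c ∧ true)) ≡ a' ∧ (b' ∧ (c' ∧ true))
∧₃-cong refl refl refl = refl

-- Each conjunct of orderIso compares one pair of positions: complementing τ negates
-- the comparison, and complementing σ negates the outcome the pattern asks for.
orderIso-complement : ∀ n {σ} → σ ∈ M → ∀ τ → All (_≤ n) τ → Unique τ →
                      orderIso (complement 3 σ) (complement n τ) ≡ orderIso σ τ
orderIso-complement n σ∈M (u ∷ v ∷ w ∷ []) (u≤ ∷ v≤ ∷ w≤ ∷ [])
                    ((u≢v ∷ u≢w ∷ []) ∷ (v≢w ∷ []) ∷ [] ∷ [])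
  with σ∈M | compl-<ᵇ-not n u≤ v≤ u≢v | compl-<ᵇ-not n u≤ w≤ u≢w | compl-<ᵇ-not n v≤ w≤ v≢w
... | here refl                 | uv | uw | vw = ∧₃-cong (not-≡-swap uv) (not-≡-swap uw) (not-≡-swap vw)
... | there (here refl)         | uv | uw | vw = ∧₃-cong (not-≡-swap uv) (not-≡-swap uw) vw
... | there (there (here refl)) | uv | uw | vw = ∧₃-cong uv (not-≡-swap uw) (not-≡-swap vw)
orderIso-complement n σ∈M τ@[] _ _ = orderIso-complement-≢3 n σ∈M τ λ ()
orderIso-complement n σ∈M τ@(_ ∷ []) _ _ = orderIso-complement-≢3 n σ∈M τ λ ()
orderIso-complement n σ∈M τ@(_ ∷ _ ∷ []) _ _ = orderIso-complement-≢3 n σ∈M τ λ ()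
orderIso-complement n σ∈M τ@(_ ∷ _ ∷ _ ∷ _ ∷ _) _ _ = orderIso-complement-≢3 n σ∈M τ λ ()

subseqs-map : ∀ (f : ℕ → ℕ) xs → subseqs (map f xs) ≡ map (map f) (subseqs xs)
subseqs-map f [] = refl
subseqs-map f (x ∷ xs) = begin
  map (f x ∷_) (subseqs (map f xs)) ++ subseqs (map f xs)
    ≡⟨ cong (λ ys → map (f x ∷_) ys ++ ys) (subseqs-map f xs) ⟩
  map (f x ∷_) (map (map f) (subseqs xs)) ++ map (map f) (subseqs xs)
    ≡⟨ cong (_++ map (map f) (subseqs xs)) (≡-trans (sym (map-∘ (subseqs xs))) (map-∘ (subseqs xs))) ⟩
  map (map f) (map (x ∷_) (subseqs xs)) ++ map (map f) (subseqs xs)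
    ≡⟨ map-++ (map f) (map (x ∷_) (subseqs xs)) (subseqs xs) ⟨
  map (map f) (map (x ∷_) (subseqs xs) ++ subseqs xs) ∎
  where open ≡-Reasoning

subseqs-All : ∀ {P : ℕ → Set} {xs} → All P xs → All (All P) (subseqs xs)
subseqs-All [] = [] ∷ []
subseqs-All (px ∷ pxs) = AllP.++⁺ (AllP.map⁺ (All.map (px ∷_) (subseqs-All pxs))) (subseqs-All pxs)

subseqs-Unique : ∀ {xs} → Unique xs → All Unique (subseqs xs)
subseqs-Unique [] = [] ∷ []
subseqs-Unique (x∉xs ∷ xs!) = AllP.++⁺
  (AllP.map⁺ (All.zipWith (λ (x∉τ , τ!) → x∉τ ∷ τ!) (subseqs-All x∉xs , subseqs-Unique xs!)))
  (subseqs-Unique xs!)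

contains-complement : ∀ n {σ} → σ ∈ M → ∀ {π} → All (_≤ n) π → Unique π →
                      contains (complement n π) (complement 3 σ) ≡ contains π σ
contains-complement n {σ} σ∈M {π} π≤n π! = begin
  any (orderIso (complement 3 σ)) (subseqs (complement n π))
    ≡⟨ cong (any (orderIso (complement 3 σ))) (subseqs-map (compl n) π) ⟩
  or (map (orderIso (complement 3 σ)) (map (complement n) (subseqs π)))
    ≡⟨ cong or (map-∘ (subseqs π)) ⟨
  or (map (orderIso (complement 3 σ) ∘ complement n) (subseqs π))
    ≡⟨ cong or (map-cong-local (All.zipWith (λ (τ≤n , τ!) → orderIso-complement n σ∈M _ τ≤n τ!)
                                            (subseqs-All π≤n , subseqs-Unique π!))) ⟩
  any (orderIso σ) (subseqs π) ∎
  where open ≡-Reasoning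

avoids-↭ : ∀ π {R R'} → R ↭ R' → avoids R π ≡ avoids R' π
avoids-↭ π R↭R' =
  cong not (foldr-commMonoid (≡-setoid Bool) ∨-isCommutativeMonoid (↭⇒↭ₛ (map⁺ (contains π) R↭R')))

-- M' lists the complements of M in reverse order.
avoids-complement : ∀ n {π} → All (_≤ n) π → Unique π → avoids M' (complement n π) ≡ avoids M π
avoids-complement n {π} π≤n π! = ≡-trans
  (avoids-↭ (complement n π) (↭-reverse (map (complement 3) M)))
  (cong (not ∘ or) (map-cong-local (All.tabulate λ σ∈M → contains-complement n σ∈M π≤n π!)))

-- Runs and the major index

runsBy-All : ∀ {r} {P : ℕ → Set} {xs} → All P xs → All (All P) (runsBy r xs)
runsBy-All [] = []
runsBy-All {r} {xs = x ∷ xs} (px ∷ pxs) with runsBy r xs | runsBy-All {r} pxs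
... | [] | _ = (px ∷ []) ∷ []
... | [] ∷ rs | _ ∷ prs = (px ∷ []) ∷ prs
... | (y ∷ ys) ∷ rs | (py ∷ pys) ∷ prs with r x y
... | true = (px ∷ py ∷ pys) ∷ prs
... | false = (px ∷ []) ∷ (py ∷ pys) ∷ prs

runsBy-map : ∀ {r r' : ℕ → ℕ → Bool} {f : ℕ → ℕ} {P : ℕ → Set} →
             (∀ {x y} → P x → P y → r' (f x) (f y) ≡ r x y) →
             ∀ {xs} → All P xs → runsBy r' (map f xs) ≡ map (map f) (runsBy r xs)
runsBy-map f-transports [] = refl
runsBy-map {r} {r'} {f} f-transports {x ∷ xs} (px ∷ pxs)
  rewrite runsBy-map {r} {r'} {f} f-transports pxs with runsBy r xs | runsBy-All {r} pxs
... | [] | _ = refl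
... | [] ∷ rs | _ = refl
... | (y ∷ ys) ∷ rs | (py ∷ _) ∷ _ rewrite f-transports px py with r x y
... | true = refl
... | false = refl

countLen-map : ∀ (f : ℕ → ℕ) k rs → countLen k (map (map f) rs) ≡ countLen k rs
countLen-map f k [] = refl
countLen-map f k (r ∷ rs) rewrite length-map f r with length r ≡ᵇ k
... | true = cong suc (countLen-map f k rs)
... | false = countLen-map f k rs

countLen-descRuns-complement : ∀ n k {π} → All (_≤ n) π →
                               countLen k (descRuns (complement n π)) ≡ countLen k (ascRuns π)
countLen-descRuns-complement n k {π} π≤n =
  ≡-trans (cong (countLen k) (runsBy-map (compl-<ᵇ n) π≤n)) (countLen-map (compl n) k (ascRuns π))

positionSum : ℕ → ℕ → ℕ
positionSum k zero = 0
positionSum k (suc m) = k + positionSum (suc k) m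

positionSum-suc : ∀ k m → positionSum (suc k) m ≡ m + positionSum k m
positionSum-suc k zero = refl
positionSum-suc k (suc m) = cong suc (begin
  k + positionSum (suc (suc k)) m ≡⟨ cong (k +_) (positionSum-suc (suc k) m) ⟩
  k + (m + positionSum (suc k) m) ≡⟨ m+[n+o]≡n+[m+o] k m _ ⟩
  m + (k + positionSum (suc k) m) ∎)
  where open ≡-Reasoning

positionSum-1 : ∀ m → positionSum 1 m ≡ suc m C 2
positionSum-1 zero = refl
positionSum-1 (suc m) = begin
  suc (positionSum 2 m)        ≡⟨ cong suc (positionSum-suc 1 m) ⟩
  suc (m + positionSum 1 m)    ≡⟨ cong (λ s → suc (m + s)) (positionSum-1 m) ⟩
  suc m + suc m C 2            ≡⟨ cong (_+ suc m C 2) (nC1≡n (suc m)) ⟨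
  suc m C 1 + suc m C 2        ≡⟨ nCk+nC[k+1]≡[n+1]C[k+1] (suc m) 1 ⟩
  suc (suc m) C 2 ∎
  where open ≡-Reasoning

majFrom-complement : ∀ n k x xs → All (_≤ n) (x ∷ xs) → Unique (x ∷ xs) →
  majFrom k (x ∷ xs) + majFrom k (complement n (x ∷ xs)) ≡ positionSum k (length xs)
majFrom-complement n k x [] _ _ = refl
majFrom-complement n k x (y ∷ ys) (x≤n ∷ y≤n ∷ ys≤n) ((x≢y ∷ _) ∷ yys!)
  rewrite compl-<ᵇ n x≤n y≤n | >ᵇ≡not-<ᵇ (≢-sym x≢y)
  with y <ᵇ x | majFrom-complement n (suc k) y ys (y≤n ∷ ys≤n) yys!
... | true  | ih = ≡-trans (+-assoc k _ _) (cong (k +_) ih)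
... | false | ih = ≡-trans (m+[n+o]≡n+[m+o] (majFrom (suc k) (y ∷ ys)) k _) (cong (k +_) ih)

maj-complement : ∀ n {π} → IsPerm n π → maj π + maj (complement n π) ≡ n C 2
maj-complement .0 {[]} (_ , _ , refl) = refl
maj-complement .(suc (length xs)) {x ∷ xs} (π≤n , π! , refl) =
  ≡-trans (majFrom-complement _ 1 x xs π≤n π!) (positionSum-1 (length xs))

-- Generating functions

module _ {c ℓ : Level} (R : CommutativeRing c ℓ) where
  open CommutativeRing R
    renaming (refl to ≈-refl; sym to ≈-sym; trans to ≈-trans) hiding (_+_; zero)
  open GF R
  open import Algebra.Properties.CommutativeSemigroup *-commutativeSemigroup using (interchange)
  open import Relation.Binary.Reasoning.Setoid setoid

  sumR-↭ : ∀ {as bs} → as ↭ bs → sumR as ≈ sumR bs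
  sumR-↭ as↭bs = foldr-commMonoid setoid +-isCommutativeMonoid (↭⇒↭ₛ′ isEquivalence as↭bs)

  sumR-map-filter : ∀ (g : List ℕ → Carrier) (h : List ℕ → Bool) πs →
    sumR (map g (filter (λ π → T? (h π)) πs)) ≈ sumR (map (λ π → if h π then g π else 0#) πs)
  sumR-map-filter g h [] = ≈-refl
  sumR-map-filter g h (π ∷ πs) with h π
  ... | true = +-congˡ (sumR-map-filter g h πs)
  ... | false = ≈-trans (sumR-map-filter g h πs) (≈-sym (+-identityˡ _))

  sumR-map-cong : ∀ {g g' : List ℕ → Carrier} {πs} → All (λ π → g π ≈ g' π) πs →
                  sumR (map g πs) ≈ sumR (map g' πs)
  sumR-map-cong [] = ≈-refl
  sumR-map-cong (e ∷ es) = +-cong e (sumR-map-cong es)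

  *-distribˡ-sumR : ∀ a (g : List ℕ → Carrier) πs →
                    a * sumR (map g πs) ≈ sumR (map (λ π → a * g π) πs)
  *-distribˡ-sumR a g [] = zeroʳ a
  *-distribˡ-sumR a g (π ∷ πs) = ≈-trans (distribˡ a _ _) (+-congˡ (*-distribˡ-sumR a g πs))

  pow-+ : ∀ a m n → pow a (m + n) ≈ pow a m * pow a n
  pow-+ a zero n = ≈-sym (*-identityˡ _)
  pow-+ a (suc m) n = ≈-trans (*-congˡ (pow-+ a m n)) (≈-sym (*-assoc a _ _))

  module _ {q q⁻¹ : Carrier} (q*q⁻¹≈1 : q * q⁻¹ ≈ 1#) where

    pow-inverse : ∀ m → pow q m * pow q⁻¹ m ≈ 1#
    pow-inverse zero = *-identityˡ 1#
    pow-inverse (suc m) = begin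
      (q * pow q m) * (q⁻¹ * pow q⁻¹ m) ≈⟨ interchange q _ q⁻¹ _ ⟩
      (q * q⁻¹) * (pow q m * pow q⁻¹ m) ≈⟨ *-cong q*q⁻¹≈1 (pow-inverse m) ⟩
      1# * 1#                           ≈⟨ *-identityˡ 1# ⟩
      1# ∎

    pow-shift : ∀ X a b → X * pow q a ≈ pow q (a + b) * (X * pow q⁻¹ b)
    pow-shift X a b = begin
      X * pow q a                               ≈⟨ *-comm X _ ⟩
      pow q a * X                               ≈⟨ *-congˡ (*-identityˡ X) ⟨
      pow q a * (1# * X)                        ≈⟨ *-congˡ (*-congʳ (pow-inverse b)) ⟨
      pow q a * ((pow q b * pow q⁻¹ b) * X)     ≈⟨ *-congˡ (*-assoc _ _ X) ⟩
      pow q a * (pow q b * (pow q⁻¹ b * X))     ≈⟨ *-assoc _ _ _ ⟨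
      (pow q a * pow q b) * (pow q⁻¹ b * X)     ≈⟨ *-cong (pow-+ q a b) (*-comm X _) ⟨
      pow q (a + b) * (X * pow q⁻¹ b) ∎

  ascWeight descWeight : Carrier → Carrier → Carrier → List ℕ → Carrier
  ascWeight x y q π = pow x (countLen 1 (ascRuns π)) * pow y (countLen 2 (ascRuns π)) * pow q (maj π)
  descWeight x y q π = pow x (countLen 1 (descRuns π)) * pow y (countLen 2 (descRuns π)) * pow q (maj π)

  ascWeight-complement : ∀ n x y {q q⁻¹} → q * q⁻¹ ≈ 1# → ∀ {π} → IsPerm n π →
    ascWeight x y q π ≈ pow q (n C 2) * descWeight x y q⁻¹ (complement n π)
  ascWeight-complement n x y q*q⁻¹≈1 {π} isPerm@(π≤n , _)
    rewrite countLen-descRuns-complement n 1 π≤n | countLen-descRuns-complement n 2 π≤n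
          | sym (maj-complement n isPerm)
    = pow-shift q*q⁻¹≈1 _ (maj π) (maj (complement n π))

  sumR-Av-complement : ∀ n a (g g' : List ℕ → Carrier) →
    (∀ {π} → IsPerm n π → g π ≈ a * g' (complement n π)) →
    sumR (map g (Av n M)) ≈ a * sumR (map g' (Av n M'))
  sumR-Av-complement n a g g' g≈ag'ᶜ = begin
    sumR (map g (Av n M))
      ≈⟨ sumR-map-filter g (avoids M) (perms n) ⟩
    sumR (map (restrict M g) (perms n))
      ≈⟨ sumR-map-cong (All.tabulate restrict-complement) ⟩
    sumR (map (λ π → a * restrict M' g' (complement n π)) (perms n))
      ≈⟨ *-distribˡ-sumR a (restrict M' g' ∘ complement n) (perms n) ⟨
    a * sumR (map (restrict M' g' ∘ complement n) (perms n))
      ≡⟨ cong (λ πs → a * sumR πs) (map-∘ (perms n)) ⟩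
    a * sumR (map (restrict M' g') (map (complement n) (perms n)))
      ≈⟨ *-congˡ (sumR-↭ (map⁺ (restrict M' g') (perms-complement n))) ⟩
    a * sumR (map (restrict M' g') (perms n))
      ≈⟨ *-congˡ (sumR-map-filter g' (avoids M') (perms n)) ⟨
    a * sumR (map g' (Av n M')) ∎
    where
    restrict : List (List ℕ) → (List ℕ → Carrier) → List ℕ → Carrier
    restrict S h π = if avoids S π then h π else 0#
    restrict-complement : ∀ {π} → π ∈ perms n → restrict M g π ≈ a * restrict M' g' (complement n π)
    restrict-complement {π} π∈ with ∈perms⇒IsPerm n π∈
    ... | isPerm@(π≤n , π! , _) rewrite avoids-complement n π≤n π! with avoids M π
    ... | true = g≈ag'ᶜ isPerm
    ... | false = ≈-sym (zeroʳ a)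

lemma2p4 : ∀ {c ℓ : Level} (R : CommutativeRing c ℓ) (n : ℕ)
             (x y q q⁻¹ : CommutativeRing.Carrier R) →
             CommutativeRing._≈_ R (CommutativeRing._*_ R q q⁻¹) (CommutativeRing.1# R) →
             CommutativeRing._≈_ R (GF.FM R n x y q)
               (CommutativeRing._*_ R (GF.pow R q (n C 2)) (GF.FM' R n x y q⁻¹))
lemma2p4 R n x y q q⁻¹ q*q⁻¹≈1 =
  sumR-Av-complement R n (GF.pow R q (n C 2)) (ascWeight R x y q) (descWeight R x y q⁻¹)
    (ascWeight-complement R n x y q*q⁻¹≈1)
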